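{- (Identity expansion.) (1) For every positive proposition $A^+$, every hypothetical context $\Gamma$, inversion context $\Omega$ and succedent $U$ not of the form $[B^+]$: if $\Gamma,\langle A^+\rangle;\Omega\vdash U$ is derivable, then $\Gamma;A^+,\Omega\vdash U$ is derivable. (2) For every negative proposition $A^-$ and every hypothetical context $\Gamma$: if $\Gamma;\cdot\vdash\langle A^-\rangle$ is derivable, then $\Gamma;\cdot\vdash A^-$ is derivable. (No suspension-normality is assumed.)
   Context: Polarized propositions (each atom has a fixed polarity): $A^+ ::= p^+ \mid {\downarrow}A^- \mid \bot \mid A^+\vee B^+ \mid \top^+ \mid A^+\wedge^+ B^+$; $A^- ::= p^- \mid {\uparrow}A^+ \mid A^+\supset B^- \mid \top^- \mid A^-\wedge^- B^-$. Hypothetical contexts (multisets): $\Gamma ::= \cdot \mid \Gamma,A^- \mid \Gamma,\langle A^+\rangle$ (the latter a suspended positive proposition, which may be non-atomic). Inversion contexts $\Omega$: ordered sequences of positive propositions. Antecedents $L ::= \Omega \mid [A^-]$. Succedents $U ::= [A^+] \mid A^+ \mid A^- \mid \langle A^-\rangle$. $U$ is stable iff it is of the form $A^+$ (unbracketed) or $\langle A^-\rangle$. Sequents $\Gamma;L\vdash U$ come in three forms: right focus $\Gamma\vdash[A^+]$; inversion $\Gamma;\Omega\vdash U$ with $U$ not of the form $[A^+]$; left focus $\Gamma;[A^-]\vdash U$ with $U$ stable. Rules. Right focus: $id^+$: $\Gamma,\langle A^+\rangle\vdash[A^+]$; ${\downarrow}_R$: from $\Gamma;\cdot\vdash A^-$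 infer $\Gamma\vdash[{\downarrow}A^-]$; $\vee_{R1}$/$\vee_{R2}$: from $\Gamma\vdash[A^+]$ (resp. $[B^+]$) infer $\Gamma\vdash[A^+\vee B^+]$; $\top^+_R$: $\Gamma\vdash[\top^+]$; $\wedge^+_R$: from $\Gamma\vdash[A^+]$, $\Gamma\vdash[B^+]$ infer $\Gamma\vdash[A^+\wedge^+B^+]$. Inversion: $foc_R$: from $\Gamma\vdash[A^+]$ infer $\Gamma;\cdot\vdash A^+$; $foc_L$: from $\Gamma,A^-;[A^-]\vdash U$ with $U$ stable infer $\Gamma,A^-;\cdot\vdash U$; $\eta^+$: from $\Gamma,\langle p^+\rangle;\Omega\vdash U$ infer $\Gamma;p^+,\Omega\vdash U$ ($p^+$ atomic); ${\downarrow}_L$: from $\Gamma,A^-;\Omega\vdash U$ infer $\Gamma;{\downarrow}A^-,\Omega\vdash U$; $\bot_L$: $\Gamma;\bot,\Omega\vdash U$; $\vee_L$: from $\Gamma;A^+,\Omega\vdash U$ and $\Gamma;B^+,\Omega\vdash U$ infer $\Gamma;A^+\vee B^+,\Omega\vdash U$; $\top^+_L$: from $\Gamma;\Omega\vdash U$ infer $\Gamma;\top^+,\Omega\vdash U$; $\wedge^+_L$: from $\Gamma;A^+,B^+,\Omega\vdash U$ infer $\Gamma;A^+\wedge^+B^+,\Omega\vdash U$; $\eta^-$: from $\Gamma;\cdot\vdash\langle p^-\rangle$ infer $\Gamma;\cdot\vdash p^-$ ($p^-$ atomic); ${\uparrow}_R$: from $\Gamma;\cdot\vdash A^+$ infer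 $\Gamma;\cdot\vdash{\uparrow}A^+$; $\supset_R$: from $\Gamma;A^+\vdash B^-$ infer $\Gamma;\cdot\vdash A^+\supset B^-$; $\top^-_R$: $\Gamma;\cdot\vdash\top^-$; $\wedge^-_R$: from $\Gamma;\cdot\vdash A^-$ and $\Gamma;\cdot\vdash B^-$ infer $\Gamma;\cdot\vdash A^-\wedge^-B^-$. Left focus ($U$ stable): $id^-$: $\Gamma;[A^-]\vdash\langle A^-\rangle$; ${\uparrow}_L$: from $\Gamma;A^+\vdash U$ infer $\Gamma;[{\uparrow}A^+]\vdash U$; $\supset_L$: from $\Gamma\vdash[A^+]$ and $\Gamma;[B^-]\vdash U$ infer $\Gamma;[A^+\supset B^-]\vdash U$; $\wedge^-_{L1}$/$\wedge^-_{L2}$: from $\Gamma;[A^-]\vdash U$ (resp. $[B^-]$) infer $\Gamma;[A^-\wedge^-B^-]\vdash U$. (No $\bot_R$, no $\top^-_L$.) -}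

module Defs where

open import Data.Nat using (ℕ)
open import Data.List using (List; []; _∷_)
open import Data.List.Membership.Propositional using (_∈_)

-- Atoms: positive atoms and negative atoms are drawn from disjoint
-- (countable) supplies, each atom having a fixed polarity.
PAtom : Set
PAtom = ℕ

NAtom : Set
NAtom = ℕ

mutual
  data Pos : Set where
    patom : PAtom → Pos
    ↓_    : Neg → Pos
    ⊥⁺    : Pos
    _∨_   : Pos → Pos → Pos
    ⊤⁺    : Pos
    _∧⁺_  : Pos → Pos → Pos

  data Neg : Set where
    natom : NAtom → Neg
    ↑_    : Pos → Neg
    _⊃_   : Pos → Neg → Neg
    ⊤⁻    : Neg
    _∧⁻_  : Neg → Neg → Neg

-- Hypotheses: A⁻ or a suspended positive proposition ⟨A⁺⟩ (possibly non-atomic).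
data Hyp : Set where
  neg  : Neg → Hyp
  susp : Pos → Hyp

-- Hypothetical contexts: multisets, represented as lists; all rules only
-- inspect membership or extend the context, so order is irrelevant.
Ctx : Set
Ctx = List Hyp

InvCtx : Set
InvCtx = List Pos

-- Succedents U that are NOT of the form [A⁺] (those allowed in inversion
-- and left-focus sequents): A⁺, A⁻, ⟨A⁻⟩.
data Succ : Set where
  pos   : Pos → Succ
  negU  : Neg → Succ
  suspU : Neg → Succ

data Stable : Succ → Set where
  st-pos  : ∀ {A} → Stable (pos A)
  st-susp : ∀ {A} → Stable (suspU A)

infixr 6 _∧⁺_ _∧⁻_
infixr 5 _∨_
infixr 4 _⊃_

mutual
  data _⊢[_] : Ctx → Pos → Set where
    id⁺  : ∀ {Γ A} → susp A ∈ Γ → Γ ⊢[ A ]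
    ↓R   : ∀ {Γ A} → Γ ⨾ [] ⊢ negU A → Γ ⊢[ ↓ A ]
    ∨R1  : ∀ {Γ A B} → Γ ⊢[ A ] → Γ ⊢[ A ∨ B ]
    ∨R2  : ∀ {Γ A B} → Γ ⊢[ B ] → Γ ⊢[ A ∨ B ]
    ⊤⁺R  : ∀ {Γ} → Γ ⊢[ ⊤⁺ ]
    ∧⁺R  : ∀ {Γ A B} → Γ ⊢[ A ] → Γ ⊢[ B ] → Γ ⊢[ A ∧⁺ B ]

  data _⨾_⊢_ : Ctx → InvCtx → Succ → Set where
    focR : ∀ {Γ A} → Γ ⊢[ A ] → Γ ⨾ [] ⊢ pos A
    focL : ∀ {Γ A U} → neg A ∈ Γ → Stable U → Γ ⨾[ A ]⊢ U → Γ ⨾ [] ⊢ U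
    η⁺   : ∀ {Γ p Ω U} → (susp (patom p) ∷ Γ) ⨾ Ω ⊢ U → Γ ⨾ (patom p ∷ Ω) ⊢ U
    ↓L   : ∀ {Γ A Ω U} → (neg A ∷ Γ) ⨾ Ω ⊢ U → Γ ⨾ (↓ A ∷ Ω) ⊢ U
    ⊥L   : ∀ {Γ Ω U} → Γ ⨾ (⊥⁺ ∷ Ω) ⊢ U
    ∨L   : ∀ {Γ A B Ω U} → Γ ⨾ (A ∷ Ω) ⊢ U → Γ ⨾ (B ∷ Ω) ⊢ U → Γ ⨾ ((A ∨ B) ∷ Ω) ⊢ U
    ⊤⁺L  : ∀ {Γ Ω U} → Γ ⨾ Ω ⊢ U → Γ ⨾ (⊤⁺ ∷ Ω) ⊢ U
    ∧⁺L  : ∀ {Γ A B Ω U} → Γ ⨾ (A ∷ B ∷ Ω) ⊢ U → Γ ⨾ ((A ∧⁺ B) ∷ Ω) ⊢ U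
    η⁻   : ∀ {Γ p} → Γ ⨾ [] ⊢ suspU (natom p) → Γ ⨾ [] ⊢ negU (natom p)
    ↑R   : ∀ {Γ A} → Γ ⨾ [] ⊢ pos A → Γ ⨾ [] ⊢ negU (↑ A)
    ⊃R   : ∀ {Γ A B} → Γ ⨾ (A ∷ []) ⊢ negU B → Γ ⨾ [] ⊢ negU (A ⊃ B)
    ⊤⁻R  : ∀ {Γ} → Γ ⨾ [] ⊢ negU ⊤⁻
    ∧⁻R  : ∀ {Γ A B} → Γ ⨾ [] ⊢ negU A → Γ ⨾ [] ⊢ negU B → Γ ⨾ [] ⊢ negU (A ∧⁻ B)

  data _⨾[_]⊢_ : Ctx → Neg → Succ → Set where
    id⁻  : ∀ {Γ A} → Γ ⨾[ A ]⊢ suspU A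
    ↑L   : ∀ {Γ A U} → Stable U → Γ ⨾ (A ∷ []) ⊢ U → Γ ⨾[ ↑ A ]⊢ U
    ⊃L   : ∀ {Γ A B U} → Γ ⊢[ A ] → Γ ⨾[ B ]⊢ U → Γ ⨾[ A ⊃ B ]⊢ U
    ∧⁻L1 : ∀ {Γ A B U} → Γ ⨾[ A ]⊢ U → Γ ⨾[ A ∧⁻ B ]⊢ U
    ∧⁻L2 : ∀ {Γ A B U} → Γ ⨾[ B ]⊢ U → Γ ⨾[ A ∧⁻ B ]⊢ U

module Submission where

-- Both halves are proved by one simultaneous induction on the proposition.
-- A suspended positive ⟨A⁺⟩ in the context is eliminated by inverting A⁺ on
-- the left and substituting, for ⟨A⁺⟩, a right-focus proof of A⁺ built from
-- the hypotheses the inversion produced; a suspended negative succedent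
-- ⟨A⁻⟩ is eliminated by inverting A⁻ on the right and replacing every use
-- of id⁻ on A⁻ with a left-focus proof built from the new hypotheses.

open import Defs
open import Function using (_∘_)
open import Data.Product using (_×_; _,_)
open import Data.List using (_∷_; [])
open import Data.List.Relation.Unary.Any using (here; there)
open import Data.List.Membership.Propositional using (_∈_)
open import Data.List.Relation.Binary.Subset.Propositional using (_⊆_)
open import Data.List.Relation.Binary.Subset.Propositional.Properties
  using (⊆-refl; ∷⁺ʳ)
open import Relation.Binary.PropositionalEquality using (refl)

mutual
  weakenR : ∀ {Γ Δ A} → Γ ⊆ Δ → Γ ⊢[ A ] → Δ ⊢[ A ]
  weakenR Γ⊆Δ (id⁺ x)   = id⁺ (Γ⊆Δ x)
  weakenR Γ⊆Δ (↓R d)    = ↓R (weakenI Γ⊆Δ d)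
  weakenR Γ⊆Δ (∨R1 d)   = ∨R1 (weakenR Γ⊆Δ d)
  weakenR Γ⊆Δ (∨R2 d)   = ∨R2 (weakenR Γ⊆Δ d)
  weakenR Γ⊆Δ ⊤⁺R       = ⊤⁺R
  weakenR Γ⊆Δ (∧⁺R d e) = ∧⁺R (weakenR Γ⊆Δ d) (weakenR Γ⊆Δ e)

  weakenI : ∀ {Γ Δ Ω U} → Γ ⊆ Δ → Γ ⨾ Ω ⊢ U → Δ ⨾ Ω ⊢ U
  weakenI Γ⊆Δ (focR d)      = focR (weakenR Γ⊆Δ d)
  weakenI Γ⊆Δ (focL x st d) = focL (Γ⊆Δ x) st (weakenL Γ⊆Δ d)
  weakenI Γ⊆Δ (η⁺ d)        = η⁺ (weakenI (∷⁺ʳ _ Γ⊆Δ) d)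
  weakenI Γ⊆Δ (↓L d)        = ↓L (weakenI (∷⁺ʳ _ Γ⊆Δ) d)
  weakenI Γ⊆Δ ⊥L            = ⊥L
  weakenI Γ⊆Δ (∨L d e)      = ∨L (weakenI Γ⊆Δ d) (weakenI Γ⊆Δ e)
  weakenI Γ⊆Δ (⊤⁺L d)       = ⊤⁺L (weakenI Γ⊆Δ d)
  weakenI Γ⊆Δ (∧⁺L d)       = ∧⁺L (weakenI Γ⊆Δ d)
  weakenI Γ⊆Δ (η⁻ d)        = η⁻ (weakenI Γ⊆Δ d)
  weakenI Γ⊆Δ (↑R d)        = ↑R (weakenI Γ⊆Δ d)
  weakenI Γ⊆Δ (⊃R d)        = ⊃R (weakenI Γ⊆Δ d)
  weakenI Γ⊆Δ ⊤⁻R           = ⊤⁻R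
  weakenI Γ⊆Δ (∧⁻R d e)     = ∧⁻R (weakenI Γ⊆Δ d) (weakenI Γ⊆Δ e)

  weakenL : ∀ {Γ Δ A U} → Γ ⊆ Δ → Γ ⨾[ A ]⊢ U → Δ ⨾[ A ]⊢ U
  weakenL Γ⊆Δ id⁻        = id⁻
  weakenL Γ⊆Δ (↑L st d)  = ↑L st (weakenI Γ⊆Δ d)
  weakenL Γ⊆Δ (⊃L d e)   = ⊃L (weakenR Γ⊆Δ d) (weakenL Γ⊆Δ e)
  weakenL Γ⊆Δ (∧⁻L1 d)   = ∧⁻L1 (weakenL Γ⊆Δ d)
  weakenL Γ⊆Δ (∧⁻L2 d)   = ∧⁻L2 (weakenL Γ⊆Δ d)

record Subst (Γ Δ : Ctx) : Set where
  field
    keepNeg   : ∀ {A} → neg A ∈ Γ → neg A ∈ Δ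
    proveSusp : ∀ {A} → susp A ∈ Γ → Δ ⊢[ A ]
open Subst

liftSubst : ∀ {Γ Δ h} → Subst Γ Δ → Subst (h ∷ Γ) (h ∷ Δ)
keepNeg   (liftSubst σ) (here refl) = here refl
keepNeg   (liftSubst σ) (there x)   = there (keepNeg σ x)
proveSusp (liftSubst σ) (here refl) = id⁺ (here refl)
proveSusp (liftSubst σ) (there x)   = weakenR there (proveSusp σ x)

mutual
  substR : ∀ {Γ Δ A} → Subst Γ Δ → Γ ⊢[ A ] → Δ ⊢[ A ]
  substR σ (id⁺ x)   = proveSusp σ x
  substR σ (↓R d)    = ↓R (substI σ d)
  substR σ (∨R1 d)   = ∨R1 (substR σ d)
  substR σ (∨R2 d)   = ∨R2 (substR σ d)
  substR σ ⊤⁺R       = ⊤⁺R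
  substR σ (∧⁺R d e) = ∧⁺R (substR σ d) (substR σ e)

  substI : ∀ {Γ Δ Ω U} → Subst Γ Δ → Γ ⨾ Ω ⊢ U → Δ ⨾ Ω ⊢ U
  substI σ (focR d)      = focR (substR σ d)
  substI σ (focL x st d) = focL (keepNeg σ x) st (substL σ d)
  substI σ (η⁺ d)        = η⁺ (substI (liftSubst σ) d)
  substI σ (↓L d)        = ↓L (substI (liftSubst σ) d)
  substI σ ⊥L            = ⊥L
  substI σ (∨L d e)      = ∨L (substI σ d) (substI σ e)
  substI σ (⊤⁺L d)       = ⊤⁺L (substI σ d)
  substI σ (∧⁺L d)       = ∧⁺L (substI σ d)
  substI σ (η⁻ d)        = η⁻ (substI σ d)
  substI σ (↑R d)        = ↑R (substI σ d)
  substI σ (⊃R d)        = ⊃R (substI σ d)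
  substI σ ⊤⁻R           = ⊤⁻R
  substI σ (∧⁻R d e)     = ∧⁻R (substI σ d) (substI σ e)

  substL : ∀ {Γ Δ A U} → Subst Γ Δ → Γ ⨾[ A ]⊢ U → Δ ⨾[ A ]⊢ U
  substL σ id⁻       = id⁻
  substL σ (↑L st d) = ↑L st (substI σ d)
  substL σ (⊃L d e)  = ⊃L (substR σ d) (substL σ e)
  substL σ (∧⁻L1 d)  = ∧⁻L1 (substL σ d)
  substL σ (∧⁻L2 d)  = ∧⁻L2 (substL σ d)

discharge : ∀ {Γ Δ A Ω U} → Γ ⊆ Δ → Δ ⊢[ A ] →
            (susp A ∷ Γ) ⨾ Ω ⊢ U → Δ ⨾ Ω ⊢ U
discharge {Γ} {Δ} {A} Γ⊆Δ proof = substI σ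
  where
  σ : Subst (susp A ∷ Γ) Δ
  keepNeg   σ (there x)   = Γ⊆Δ x
  proveSusp σ (here refl) = proof
  proveSusp σ (there x)   = id⁺ (Γ⊆Δ x)

-- A replacement for the suspended succedent ⟨A⁻⟩ over Γ: a left-focus proof
-- of U from [A⁻], available in every extension of Γ (inversion below may add
-- hypotheses before id⁻ is reached).
Replacement : Ctx → Neg → Succ → Set
Replacement Γ A U = ∀ {Δ} → Γ ⊆ Δ → Δ ⨾[ A ]⊢ U

extendReplacement : ∀ {Γ A U h} → Replacement Γ A U → Replacement (h ∷ Γ) A U
extendReplacement r Γ⊆Δ = r (Γ⊆Δ ∘ there)

-- No rule
-- other than id⁻ introduces ⟨A⁻⟩, and the remaining rules are insensitive to
-- which stable succedent is carried.
mutual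
  replaceI : ∀ {Γ Ω A U} → Stable U → Replacement Γ A U →
             Γ ⨾ Ω ⊢ suspU A → Γ ⨾ Ω ⊢ U
  replaceI st r (focL x _ d) = focL x st (replaceL st r d)
  replaceI st r (η⁺ d)       = η⁺ (replaceI st (extendReplacement r) d)
  replaceI st r (↓L d)       = ↓L (replaceI st (extendReplacement r) d)
  replaceI st r ⊥L           = ⊥L
  replaceI st r (∨L d e)     = ∨L (replaceI st r d) (replaceI st r e)
  replaceI st r (⊤⁺L d)      = ⊤⁺L (replaceI st r d)
  replaceI st r (∧⁺L d)      = ∧⁺L (replaceI st r d)

  replaceL : ∀ {Γ B A U} → Stable U → Replacement Γ A U →
             Γ ⨾[ B ]⊢ suspU A → Γ ⨾[ B ]⊢ U
  replaceL st r id⁻        = r ⊆-refl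
  replaceL st r (↑L _ d)   = ↑L st (replaceI st r d)
  replaceL st r (⊃L d e)   = ⊃L d (replaceL st r e)
  replaceL st r (∧⁻L1 d)   = ∧⁻L1 (replaceL st r d)
  replaceL st r (∧⁻L2 d)   = ∧⁻L2 (replaceL st r d)

mutual
  -- Invert A⁺ and discharge ⟨A⁺⟩ by the
  -- right-focus proof of A⁺ from the resulting hypotheses; for ↓A⁻ that
  -- proof needs expansion (2) of A⁻.
  expandPos : (A : Pos) (Γ : Ctx) (Ω : InvCtx) (U : Succ) →
              (susp A ∷ Γ) ⨾ Ω ⊢ U → Γ ⨾ (A ∷ Ω) ⊢ U
  expandPos (patom p) Γ Ω U d = η⁺ d
  expandPos (↓ A) Γ Ω U d =
    ↓L (discharge there (↓R (expandNeg A (neg A ∷ Γ) useHyp)) d)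
    where
    useHyp : (neg A ∷ Γ) ⨾ [] ⊢ suspU A
    useHyp = focL (here refl) st-susp id⁻
  expandPos ⊥⁺ Γ Ω U d = ⊥L
  expandPos (A ∨ B) Γ Ω U d =
    ∨L (expandPos A Γ Ω U (discharge there (∨R1 (id⁺ (here refl))) d))
       (expandPos B Γ Ω U (discharge there (∨R2 (id⁺ (here refl))) d))
  expandPos ⊤⁺ Γ Ω U d = ⊤⁺L (discharge ⊆-refl ⊤⁺R d)
  expandPos (A ∧⁺ B) Γ Ω U d =
    ∧⁺L (expandPos A Γ (B ∷ Ω) U (expandPos B (susp A ∷ Γ) Ω U
      (discharge (there ∘ there) pair d)))
    where
    pair : (susp B ∷ susp A ∷ Γ) ⊢[ A ∧⁺ B ]
    pair = ∧⁺R (id⁺ (there (here refl))) (id⁺ (here refl))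

  -- Invert A⁻ on the right and replace each id⁻ on A⁻ by the matching left
  -- focus on A⁻; for ↑A⁺ and A⁺ ⊃ B⁻ this needs expansion (1) of A⁺.
  expandNeg : (A : Neg) (Γ : Ctx) → Γ ⨾ [] ⊢ suspU A → Γ ⨾ [] ⊢ negU A
  expandNeg (natom p) Γ d = η⁻ d
  expandNeg (↑ A) Γ d = ↑R (replaceI st-pos focusUp d)
    where
    focusUp : Replacement Γ (↑ A) (pos A)
    focusUp {Δ} _ = ↑L st-pos (expandPos A Δ [] (pos A) (focR (id⁺ (here refl))))
  expandNeg (A ⊃ B) Γ d =
    ⊃R (expandPos A Γ [] (negU B)
         (expandNeg B (susp A ∷ Γ) (replaceI st-susp apply (weakenI there d))))
    where
    apply : Replacement (susp A ∷ Γ) (A ⊃ B) (suspU B)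
    apply Γ⊆Δ = ⊃L (id⁺ (Γ⊆Δ (here refl))) id⁻
  expandNeg ⊤⁻ Γ d = ⊤⁻R
  expandNeg (A ∧⁻ B) Γ d =
    ∧⁻R (expandNeg A Γ (replaceI st-susp (λ _ → ∧⁻L1 id⁻) d))
        (expandNeg B Γ (replaceI st-susp (λ _ → ∧⁻L2 id⁻) d))

theorem3 : ((A : Pos) (Γ : Ctx) (Ω : InvCtx) (U : Succ) →
    (susp A ∷ Γ) ⨾ Ω ⊢ U → Γ ⨾ (A ∷ Ω) ⊢ U)
    × ((A : Neg) (Γ : Ctx) →
    Γ ⨾ [] ⊢ suspU A → Γ ⨾ [] ⊢ negU A)
theorem3 = expandPos , expandNeg
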